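{- Let $G$ be a finite simple graph with $n$ vertices and $e(G)$ edges, let $A\subseteq V(G)$ be a $\delta_1$-small set of $G$ with $V(G)\setminus A\neq\emptyset$, and let $s=D_1(V(G)\setminus A)$. Then $$|A|\leq\left\lfloor\frac{n-s}{2}+\sqrt{\frac{(n-s)^2}{4}+ns-2e(G)}\right\rfloor.$$
   Context: $d(v)$ is the degree of $v$. For nonempty $W\subseteq V(G)$, $D_1(W)=\frac{1}{|W|}\sum_{v\in W}d(v)$ (average degree over $W$). $W$ is a $\delta_1$-small set if $D_1(W)\leq n-|W|$. -}

module Defs where

open import Data.Bool using (Bool; true; false; if_then_else_; _∧_)
open import Data.Nat as ℕ using (ℕ; zero; suc; NonZero)
open import Data.Fin using (Fin; toℕ)
open import Data.Fin.Subset using (Subset; ∣_∣; Nonempty; _∈_; inside; outside; ∁)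
open import Data.Vec using (Vec; []; _∷_; here; there; lookup; tabulate; allFin; countᵇ; sum)
open import Data.Vec.Relation.Unary.Any using ()
open import Data.Integer using (+_)
open import Data.Rational using (ℚ; _/_; _+_; _*_; _-_; _≤_; 0ℚ; ½; _÷_)
open import Data.Product using (_×_; _,_)
open import Data.Sum using (_⊎_)
open import Relation.Binary.PropositionalEquality using (_≡_)

record Graph (n : ℕ) : Set where
  field
    adj    : Fin n → Fin n → Bool
    sym    : ∀ u v → adj u v ≡ adj v u
    irrefl : ∀ v → adj v v ≡ false
open Graph public

ℕ→ℚ : ℕ → ℚ
ℕ→ℚ k = + k / 1

deg : ∀ {n} → Graph n → Fin n → ℕ
deg {n} G v = countᵇ (adj G v) (allFin n)

edges : ∀ {n} → Graph n → ℕ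
edges {n} G = sum (tabulate λ u → countᵇ (λ v → (toℕ u ℕ.<ᵇ toℕ v) ∧ adj G u v) (allFin n))

degSum : ∀ {n} → Graph n → Subset n → ℕ
degSum {n} G W = sum (tabulate λ v → if lookup W v then deg G v else 0)

nonempty⇒nonZero : ∀ {n} (W : Subset n) → Nonempty W → NonZero ∣ W ∣
nonempty⇒nonZero (inside ∷ W) _ = _
nonempty⇒nonZero (outside ∷ W) (Fin.zero , ())
nonempty⇒nonZero (outside ∷ W) (Fin.suc x , there x∈W) = nonempty⇒nonZero W (x , x∈W)

D₁ : ∀ {n} → Graph n → (W : Subset n) → Nonempty W → ℚ
D₁ G W ne = (+ degSum G W / ∣ W ∣) {{nonempty⇒nonZero W ne}}

δ₁-small : ∀ {n} → Graph n → Subset n → Set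
δ₁-small {n} G W = Σ (Nonempty W) λ ne → D₁ G W ne ≤ (ℕ→ℚ n - ℕ→ℚ ∣ W ∣)
  where open import Data.Product using (Σ)

-- "x ≤ √D" for rationals (literally: √D is a real number, i.e. D ≥ 0,
-- and x ≤ √D, which for real √D ≥ 0 means x ≤ 0 or x² ≤ D).
_≤√_ : ℚ → ℚ → Set
x ≤√ D = (0ℚ ≤ D) × (x ≤ 0ℚ ⊎ x * x ≤ D)

-- For a natural number k: k ≤ ⌊ h + √D ⌋  ⟺  k ≤ h + √D  ⟺  k - h ≤ √D
-- (floor of a real y satisfies k ≤ ⌊y⌋ ⟺ k ≤ y for integers k).
_≤⌊_+√_⌋ : ℕ → ℚ → ℚ → Set
k ≤⌊ h +√ D ⌋ = (ℕ→ℚ k - h) ≤√ D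

-- Write a = |A|, b = |V∖A| (so n = a + b), d(A) for the degree sum over A and
-- s = D₁(V∖A), so that d(V∖A) = b·s.  The bound  |A| ≤ ⌊h + √Δ⌋  with
-- h = (n−s)/2 and Δ = (n−s)²/4 + ns − 2e(G) amounts to  x² ≤ Δ  for
-- x = a − h.  Completing the square gives, identically in the rationals,
--     Δ = x² + (ab − d(A))   whenever   2e(G) = d(A) + b·s  and  n = a + b,
-- and δ₁-smallness of A, multiplied by a, says exactly d(A) ≤ ab.
module Submission where

open import Defs hiding (sym)
open import Data.Nat using (ℕ)
open import Data.Fin.Subset using (Subset; ∣_∣; Nonempty; ∁)
open import Data.Rational using (_+_; _*_; _-_; ½)

open import Data.Bool using (Bool; true; false; if_then_else_; _∧_; not)
open import Data.Empty using (⊥-elim)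
open import Data.Nat as ℕ using (zero; suc)
import Data.Nat.Properties as ℕP
open import Data.Fin using (Fin; toℕ)
import Data.Fin.Properties as FinP
open import Data.Fin.Subset.Properties using (∣∁p∣≡n∸∣p∣; ∣p∣≤n)
open import Data.Vec using (tabulate; lookup; countᵇ) renaming (sum to vsum)
open import Data.Vec.Properties using (lookup-map)
import Data.Integer as ℤ
import Data.Integer.Properties as ℤP
open import Data.Rational as ℚ using (ℚ; 0ℚ; -_; _≤_; fromℚᵘ; toℚᵘ; nonNegative; nonPositive)
open import Data.Rational.Properties
open import Data.Rational.Solver using (module +-*-Solver)
open import Data.Rational.Unnormalised as ℚᵘ using (ℚᵘ; mkℚᵘ)
import Data.Rational.Unnormalised.Properties as ℚᵘP
open import Data.Product using (_,_)
open import Data.Sum using (inj₁; inj₂)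
open import Relation.Nullary.Reflects using (ofʸ; ofⁿ)
open import Relation.Binary.Definitions using (tri<; tri≈; tri>)
open import Relation.Binary.PropositionalEquality
open import Algebra.Properties.CommutativeMonoid.Sum ℕP.+-0-commutativeMonoid
  using (sum-syntax; ∑-distrib-+; ∑-comm; sum-cong-≗)

χ : Bool → ℕ
χ true  = 1
χ false = 0

sum-tabulate : ∀ {n} (f : Fin n → ℕ) → vsum (tabulate f) ≡ ∑[ i < n ] f i
sum-tabulate {zero}  f = refl
sum-tabulate {suc n} f = cong (f Fin.zero ℕ.+_) (sum-tabulate (λ i → f (Fin.suc i)))

countᵇ-tabulate : ∀ {a} {A : Set a} {n} (p : A → Bool) (f : Fin n → A) →
                  countᵇ p (tabulate f) ≡ ∑[ i < n ] χ (p (f i))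
countᵇ-tabulate {n = zero}  p f = refl
countᵇ-tabulate {n = suc n} p f with p (f Fin.zero)
... | true  = cong suc (countᵇ-tabulate p (λ i → f (Fin.suc i)))
... | false = countᵇ-tabulate p (λ i → f (Fin.suc i))

module _ {n : ℕ} (G : Graph n) where

  deg-∑ : ∀ v → deg G v ≡ ∑[ w < n ] χ (adj G v w)
  deg-∑ v = countᵇ-tabulate (adj G v) (λ w → w)

  isUpEdge : Fin n → Fin n → Bool
  isUpEdge u v = (toℕ u ℕ.<ᵇ toℕ v) ∧ adj G u v

  upEdge : Fin n → Fin n → ℕ
  upEdge u v = χ (isUpEdge u v)

  edges-∑ : edges G ≡ ∑[ u < n ] ∑[ v < n ] upEdge u v
  edges-∑ = trans (sum-tabulate (λ u → countᵇ (isUpEdge u) (tabulate (λ v → v))))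
                  (sum-cong-≗ (λ u → countᵇ-tabulate (isUpEdge u) (λ v → v)))

  -- An adjacency u ~ v is counted by exactly one of its two orientations
  -- (none when u = v, by irreflexivity; by symmetry otherwise).
  adj-orientations : ∀ u v → χ (adj G u v) ≡ upEdge u v ℕ.+ upEdge v u
  adj-orientations u v
    with toℕ u ℕ.<ᵇ toℕ v | ℕP.<ᵇ-reflects-< (toℕ u) (toℕ v)
       | toℕ v ℕ.<ᵇ toℕ u | ℕP.<ᵇ-reflects-< (toℕ v) (toℕ u)
  ... | true  | ofʸ u<v | true  | ofʸ v<u = ⊥-elim (ℕP.<-asym u<v v<u)
  ... | true  | _       | false | _       = sym (ℕP.+-identityʳ _)
  ... | false | _       | true  | _       = cong χ (Graph.sym G u v)
  ... | false | ofⁿ u≮v | false | ofⁿ v≮u with FinP.<-cmp u v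
  ...   | tri< u<v _ _ = ⊥-elim (u≮v u<v)
  ...   | tri> _ _ v<u = ⊥-elim (v≮u v<u)
  ...   | tri≈ _ refl _ = cong χ (irrefl G u)

  handshake : 2 ℕ.* edges G ≡ ∑[ v < n ] deg G v
  handshake = begin
    2 ℕ.* edges G                                    ≡⟨ cong (2 ℕ.*_) edges-∑ ⟩
    E ℕ.+ (E ℕ.+ 0)                                  ≡⟨ cong (E ℕ.+_) (trans (ℕP.+-identityʳ E) (∑-comm upEdge)) ⟩
    E ℕ.+ ∑[ u < n ] ∑[ v < n ] upEdge v u           ≡⟨ sym (∑-distrib-+ (λ u → ∑[ v < n ] upEdge u v) _) ⟩
    ∑[ u < n ] (∑[ v < n ] upEdge u v ℕ.+ ∑[ v < n ] upEdge v u)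
                                                     ≡⟨ sum-cong-≗ (λ u → sym (∑-distrib-+ (upEdge u) (λ v → upEdge v u))) ⟩
    ∑[ u < n ] ∑[ v < n ] (upEdge u v ℕ.+ upEdge v u) ≡⟨ sum-cong-≗ (λ u → sum-cong-≗ (λ v → sym (adj-orientations u v))) ⟩
    ∑[ u < n ] ∑[ v < n ] χ (adj G u v)              ≡⟨ sum-cong-≗ (λ u → sym (deg-∑ u)) ⟩
    ∑[ u < n ] deg G u                               ∎
    where
    open ≡-Reasoning
    E : ℕ
    E = ∑[ u < n ] ∑[ v < n ] upEdge u v

  degSum-complement : (W : Subset n) → degSum G W ℕ.+ degSum G (∁ W) ≡ ∑[ v < n ] deg G v
  degSum-complement W = begin
    degSum G W ℕ.+ degSum G (∁ W)          ≡⟨ cong₂ ℕ._+_ (sum-tabulate inW) (sum-tabulate in∁W) ⟩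
    ∑[ v < n ] inW v ℕ.+ ∑[ v < n ] in∁W v ≡⟨ sym (∑-distrib-+ inW in∁W) ⟩
    ∑[ v < n ] (inW v ℕ.+ in∁W v)          ≡⟨ sum-cong-≗ split ⟩
    ∑[ v < n ] deg G v                     ∎
    where
    open ≡-Reasoning
    inW in∁W : Fin n → ℕ
    inW  v = if lookup W v then deg G v else 0
    in∁W v = if lookup (∁ W) v then deg G v else 0
    split : ∀ v → inW v ℕ.+ in∁W v ≡ deg G v
    split v rewrite lookup-map v not W with lookup W v
    ... | true  = ℕP.+-identityʳ (deg G v)
    ... | false = refl

  twice-edges : (W : Subset n) → 2 ℕ.* edges G ≡ degSum G W ℕ.+ degSum G (∁ W)
  twice-edges W = trans handshake (sym (degSum-complement W))

fromℚᵘ-homo-+ : ∀ p q → fromℚᵘ (p ℚᵘ.+ q) ≡ fromℚᵘ p + fromℚᵘ q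
fromℚᵘ-homo-+ p q = toℚᵘ-injective (begin
  toℚᵘ (fromℚᵘ (p ℚᵘ.+ q))              ≈⟨ toℚᵘ-fromℚᵘ (p ℚᵘ.+ q) ⟩
  p ℚᵘ.+ q                              ≈⟨ ℚᵘP.+-cong (toℚᵘ-fromℚᵘ p) (toℚᵘ-fromℚᵘ q) ⟨
  toℚᵘ (fromℚᵘ p) ℚᵘ.+ toℚᵘ (fromℚᵘ q)  ≈⟨ toℚᵘ-homo-+ (fromℚᵘ p) (fromℚᵘ q) ⟨
  toℚᵘ (fromℚᵘ p + fromℚᵘ q)            ∎)
  where open ℚᵘP.≃-Reasoning

fromℚᵘ-homo-* : ∀ p q → fromℚᵘ (p ℚᵘ.* q) ≡ fromℚᵘ p * fromℚᵘ q
fromℚᵘ-homo-* p q = toℚᵘ-injective (begin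
  toℚᵘ (fromℚᵘ (p ℚᵘ.* q))              ≈⟨ toℚᵘ-fromℚᵘ (p ℚᵘ.* q) ⟩
  p ℚᵘ.* q                              ≈⟨ ℚᵘP.*-cong (toℚᵘ-fromℚᵘ p) (toℚᵘ-fromℚᵘ q) ⟨
  toℚᵘ (fromℚᵘ p) ℚᵘ.* toℚᵘ (fromℚᵘ q)  ≈⟨ toℚᵘ-homo-* (fromℚᵘ p) (fromℚᵘ q) ⟨
  toℚᵘ (fromℚᵘ p * fromℚᵘ q)            ∎)
  where open ℚᵘP.≃-Reasoning

[_]ᵘ : ℕ → ℚᵘ
[ k ]ᵘ = mkℚᵘ (ℤ.+ k) 0

ℕ→ℚ-+ : ∀ m k → ℕ→ℚ (m ℕ.+ k) ≡ ℕ→ℚ m + ℕ→ℚ k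
ℕ→ℚ-+ m k = trans (cong (λ z → fromℚᵘ (mkℚᵘ z 0)) sum≡) (fromℚᵘ-homo-+ [ m ]ᵘ [ k ]ᵘ)
  where
  sum≡ : ℤ.+ (m ℕ.+ k) ≡ ℤ.+ m ℤ.* ℤ.+ 1 ℤ.+ ℤ.+ k ℤ.* ℤ.+ 1
  sum≡ = sym (cong₂ ℤ._+_ (ℤP.*-identityʳ (ℤ.+ m)) (ℤP.*-identityʳ (ℤ.+ k)))

ℕ→ℚ-* : ∀ m k → ℕ→ℚ (m ℕ.* k) ≡ ℕ→ℚ m * ℕ→ℚ k
ℕ→ℚ-* m k = trans (cong (λ z → fromℚᵘ (mkℚᵘ z 0)) (ℤP.pos-* m k)) (fromℚᵘ-homo-* [ m ]ᵘ [ k ]ᵘ)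

ℕ→ℚ-*-/ : ∀ k S .{{_ : ℕ.NonZero k}} → ℕ→ℚ k * (ℤ.+ S ℚ./ k) ≡ ℕ→ℚ S
ℕ→ℚ-*-/ k@(suc k-1) S = begin
  ℕ→ℚ k * (ℤ.+ S ℚ./ k)                    ≡⟨ fromℚᵘ-homo-* [ k ]ᵘ (mkℚᵘ (ℤ.+ S) k-1) ⟨
  fromℚᵘ ((ℤ.+ k ℤ.* ℤ.+ S) ℚᵘ./ (1 ℕ.* k)) ≡⟨ cong fromℚᵘ (ℚᵘP./-cong {ℤ.+ k ℤ.* ℤ.+ S} refl (ℕP.*-comm 1 k)) ⟩
  fromℚᵘ ((ℤ.+ k ℤ.* ℤ.+ S) ℚᵘ./ (k ℕ.* 1)) ≡⟨ fromℚᵘ-cong (ℚᵘP.*-cancelˡ-/ k {ℤ.+ S} {1}) ⟩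
  ℕ→ℚ S                                     ∎
  where open ≡-Reasoning

size*D₁ : ∀ {n} (G : Graph n) (W : Subset n) (ne : Nonempty W) →
          ℕ→ℚ ∣ W ∣ * D₁ G W ne ≡ ℕ→ℚ (degSum G W)
size*D₁ G W ne = ℕ→ℚ-*-/ ∣ W ∣ (degSum G W) {{nonempty⇒nonZero W ne}}

ℕ→ℚ-partition : ∀ {n} (A : Subset n) → ℕ→ℚ n ≡ ℕ→ℚ ∣ A ∣ + ℕ→ℚ ∣ ∁ A ∣
ℕ→ℚ-partition {n} A = trans (cong ℕ→ℚ (sym sizes)) (ℕ→ℚ-+ ∣ A ∣ ∣ ∁ A ∣)
  where
  sizes : ∣ A ∣ ℕ.+ ∣ ∁ A ∣ ≡ n
  sizes = trans (cong (∣ A ∣ ℕ.+_) (∣∁p∣≡n∸∣p∣ A)) (ℕP.m+[n∸m]≡n (∣p∣≤n A))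

twice-edges-ℚ : ∀ {n} (G : Graph n) (A : Subset n) (ne : Nonempty (∁ A)) →
                ℕ→ℚ 2 * ℕ→ℚ (edges G) ≡ ℕ→ℚ (degSum G A) + ℕ→ℚ ∣ ∁ A ∣ * D₁ G (∁ A) ne
twice-edges-ℚ G A ne = begin
  ℕ→ℚ 2 * ℕ→ℚ (edges G)                          ≡⟨ ℕ→ℚ-* 2 (edges G) ⟨
  ℕ→ℚ (2 ℕ.* edges G)                            ≡⟨ cong ℕ→ℚ (twice-edges G A) ⟩
  ℕ→ℚ (degSum G A ℕ.+ degSum G (∁ A))            ≡⟨ ℕ→ℚ-+ (degSum G A) (degSum G (∁ A)) ⟩
  ℕ→ℚ (degSum G A) + ℕ→ℚ (degSum G (∁ A))        ≡⟨ cong (ℕ→ℚ (degSum G A) +_) (size*D₁ G (∁ A) ne) ⟨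
  ℕ→ℚ (degSum G A) + ℕ→ℚ ∣ ∁ A ∣ * D₁ G (∁ A) ne ∎
  where open ≡-Reasoning

-- A δ₁-small set A has degree sum at most |A|·|V∖A|  (multiply D₁(A) ≤ n − |A| by |A|).
δ₁-small⇒degSum≤ : ∀ {n} (G : Graph n) (A : Subset n) → δ₁-small G A →
                   ℕ→ℚ (degSum G A) ≤ ℕ→ℚ ∣ A ∣ * ℕ→ℚ ∣ ∁ A ∣
δ₁-small⇒degSum≤ {n} G A (ne , D₁≤) = begin
  ℕ→ℚ (degSum G A)         ≡⟨ size*D₁ G A ne ⟨
  a * D₁ G A ne            ≤⟨ *-monoˡ-≤-nonNeg a {{normalize-nonNeg ∣ A ∣ 1}} D₁≤ ⟩
  a * (ℕ→ℚ n - a)          ≡⟨ cong (λ N → a * (N - a)) (ℕ→ℚ-partition A) ⟩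
  a * ((a + b) - a)        ≡⟨ solve 2 (λ a b → a :* ((a :+ b) :- a) := a :* b) refl a b ⟩
  a * b                    ∎
  where
  open ≤-Reasoning
  open +-*-Solver
  a b : ℚ
  a = ℕ→ℚ ∣ A ∣
  b = ℕ→ℚ ∣ ∁ A ∣

≤√-intro : ∀ {x Δ} → x * x ≤ Δ → x ≤√ Δ
≤√-intro {x} x²≤Δ = ≤-trans (square-nonNeg x) x²≤Δ , inj₂ x²≤Δ
  where
  square-nonNeg : ∀ y → 0ℚ ≤ y * y
  square-nonNeg y with ≤-total 0ℚ y
  ... | inj₁ 0≤y = subst (_≤ y * y) (*-zeroʳ y) (*-monoˡ-≤-nonNeg y {{nonNegative 0≤y}} 0≤y)
  ... | inj₂ y≤0 = subst (_≤ y * y) (*-zeroʳ y) (*-monoˡ-≤-nonPos y {{nonPositive y≤0}} y≤0)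

≤-+-difference : ∀ x {p q} → p ≤ q → x ≤ x + (q - p)
≤-+-difference x {p} {q} p≤q = subst (_≤ x + (q - p)) (+-identityʳ x)
  (+-monoʳ-≤ x (subst (_≤ q - p) (+-inverseʳ p) (+-monoˡ-≤ (- p) p≤q)))

square-completion : ∀ {N a b s d P} → N ≡ a + b → P ≡ d + b * s →
  ((N - s) * (N - s)) * (½ * ½) + N * s - P ≡ (a - (N - s) * ½) * (a - (N - s) * ½) + (a * b - d)
square-completion {a = a} {b} {s} {d} refl refl =
  solve 4 (λ a b s d →
             (((a :+ b) :- s) :* ((a :+ b) :- s)) :* (con ½ :* con ½) :+ (a :+ b) :* s :- (d :+ b :* s)
           := (a :- ((a :+ b) :- s) :* con ½) :* (a :- ((a :+ b) :- s) :* con ½) :+ (a :* b :- d))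
          refl a b s d
  where open +-*-Solver

theorem5p5 : (n : ℕ) (G : Graph n) (A : Subset n) → δ₁-small G A → (ne : Nonempty (∁ A)) →
    let s = D₁ G (∁ A) ne in
    ∣ A ∣ ≤⌊ (ℕ→ℚ n - s) * ½ +√ (((ℕ→ℚ n - s) * (ℕ→ℚ n - s)) * (½ * ½) + ℕ→ℚ n * s - ℕ→ℚ 2 * ℕ→ℚ (edges G)) ⌋
theorem5p5 n G A small ne = ≤√-intro (begin
  x * x                                 ≤⟨ ≤-+-difference (x * x) (δ₁-small⇒degSum≤ G A small) ⟩
  x * x + (a * b - ℕ→ℚ (degSum G A))    ≡⟨ square-completion {a = a} {b} {s} {ℕ→ℚ (degSum G A)}
                                              (ℕ→ℚ-partition A) (twice-edges-ℚ G A ne) ⟨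
  Δ                                     ∎)
  where
  open ≤-Reasoning
  a b s x Δ : ℚ
  a = ℕ→ℚ ∣ A ∣
  b = ℕ→ℚ ∣ ∁ A ∣
  s = D₁ G (∁ A) ne
  x = a - (ℕ→ℚ n - s) * ½
  Δ = ((ℕ→ℚ n - s) * (ℕ→ℚ n - s)) * (½ * ½) + ℕ→ℚ n * s - ℕ→ℚ 2 * ℕ→ℚ (edges G)
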